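{- Let $\mathcal S=(\mathit{Sign},\mathit{Sen},\Omega,T)$ be a $\frac32$-institutional seed and $\mathcal T\subseteq\mathit{Sign}$ a (1-)subcategory such that: (i) a signature morphism is maximal if and only if it is $\mathit{Sen}$-maximal; (ii) $\mathcal T$ contains all maximal signature morphisms; (iii) if $\varphi\in\mathcal T$ and $\varphi\le\varphi'$ then $\varphi'\in\mathcal T$. Then in the $\frac32$-institution $\mathcal I(\mathcal S)$ every lax $\mathcal T$-pushout of a span of signature morphisms has weak model amalgamation.
   Context: Composition is diagrammatic. A $\frac32$-category is a category with partially ordered hom-sets and monotone composition. $\mathbf{Pfn}$: sets and partial functions ordered by graph inclusion; a partial function $f:A\rightharpoonup B$ is total if defined on all of $A$. A $\frac32$-institutional seed $(\mathit{Sign},\mathit{Sen},\Omega,T)$: a $\frac32$-category $\mathit{Sign}$, a lax $\frac32$-functor $\mathit{Sen}:\mathit{Sign}\to\mathbf{Pfn}$ (monotone: $\varphi\le\theta\Rightarrow\mathit{Sen}(\varphi)\subseteq\mathit{Sen}(\theta)$; lax: $\mathit{Sen}(\varphi);\mathit{Sen}(\varphi')\subseteq\mathit{Sen}(\varphi;\varphi')$, $1\subseteq\mathit{Sen}(1_\Sigma)$), an object $\Omega$ and $T:\mathit{Sen}(\Omega)\to\{0,1\}$. The associated $\frac32$-institution $\mathcal I(\mathcal S)$ has signatures $\mathit{Sign}$, sentences $\mathit{Sen}$, $\Sigma$-models the arrows $M:\Sigma\to\Omega$ with $\mathit{Sen}(M)$ total, reducts $\mathit{Mod}(\varphi)M'=\{M\text{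 a }\operatorname{dom}\varphi\text{ -model}\mid\varphi;M'\le M\}$, and $M\models\rho$ iff $T(\mathit{Sen}(M)\rho)=1$. An arrow $\varphi:\Sigma\to\Sigma'$ is maximal if there is no $\varphi'\ne\varphi$ with $\varphi\le\varphi'$; it is $\mathit{Sen}$-maximal if $\mathit{Sen}(\varphi)$ is total. For a span $\varphi_1:\Sigma_0\to\Sigma_1$, $\varphi_2:\Sigma_0\to\Sigma_2$, a lax cocone is a triple $\theta_k:\Sigma_k\to\Sigma$ ($k=0,1,2$) with $\varphi_1;\theta_1\le\theta_0$ and $\varphi_2;\theta_2\le\theta_0$; it is a lax $\mathcal T$-cocone if all $\theta_k\in\mathcal T$. A lax $\mathcal T$-pushout is a lax $\mathcal T$-cocone $\theta$ such that for every lax $\mathcal T$-cocone $\theta'$ of the same span there is a unique $\mu\in\mathcal T$ with $\theta_k;\mu=\theta'_k$ for $k=0,1,2$. A model of the span is a family of models $M_k$ of $\Sigma_k$ ($k=0,1,2$) with $M_0\in\mathit{Mod}(\varphi_k)M_k$ for $k=1,2$. The lax cocone has weak model amalgamation if for every model $(M_0,M_1,M_2)$ of the span there exists a $\Sigma$-model $M$ with $M_k\in\mathit{Mod}(\theta_k)M$ for $k=0,1,2$ (model amalgamation: such $M$ exists and is unique). -}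

module Defs where

open import Data.Bool using (Bool; true)
open import Data.Product using (Σ; Σ-syntax; ∃; _×_; _,_)
open import Data.Empty using (⊥)
open import Relation.Nullary using (¬_)
open import Relation.Binary.PropositionalEquality using (_≡_; _≢_)
open import Relation.Binary.Structures using (IsPartialOrder)

-- 3/2-categories: categories with partially ordered hom-sets and
-- monotone composition.  Composition is diagrammatic: f ; g  means
-- "first f, then g".

record ThreeHalfCat : Set₁ where
  infixr 9 _⨾_
  infix 4 _≤_
  field
    Obj  : Set
    Hom  : Obj → Obj → Set
    _≤_  : ∀ {A B} → Hom A B → Hom A B → Set
    ≤-po : ∀ {A B} → IsPartialOrder (_≡_ {A = Hom A B}) _≤_
    idm  : (A : Obj) → Hom A A
    _⨾_  : ∀ {A B C} → Hom A B → Hom B C → Hom A C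
    idˡ  : ∀ {A B} (f : Hom A B) → idm A ⨾ f ≡ f
    idʳ  : ∀ {A B} (f : Hom A B) → f ⨾ idm B ≡ f
    assoc : ∀ {A B C D} (f : Hom A B) (g : Hom B C) (h : Hom C D) →
            (f ⨾ g) ⨾ h ≡ f ⨾ (g ⨾ h)
    ⨾-mono : ∀ {A B C} {f f' : Hom A B} {g g' : Hom B C} →
             f ≤ f' → g ≤ g' → f ⨾ g ≤ f' ⨾ g'

-- Pfn: sets and partial functions, represented by their (functional)
-- graphs, ordered by graph inclusion.

record PFun (A B : Set) : Set₁ where
  field
    graph      : A → B → Set
    functional : ∀ {a b b'} → graph a b → graph a b' → b ≡ b'
open PFun public

_⊆ᵖ_ : ∀ {A B} → PFun A B → PFun A B → Set
f ⊆ᵖ g = ∀ a b → graph f a b → graph g a b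

_⨾ᵖ_ : ∀ {A B C} → PFun A B → PFun B C → PFun A C
graph (f ⨾ᵖ g) a c = Σ[ b ∈ _ ] (graph f a b × graph g b c)
functional (f ⨾ᵖ g) (b , p , q) (b' , p' , q')
  with functional f p p'
... | Relation.Binary.PropositionalEquality.refl = functional g q q'

idᵖ : (A : Set) → PFun A A
graph (idᵖ A) a b = a ≡ b
functional (idᵖ A) Relation.Binary.PropositionalEquality.refl
                   Relation.Binary.PropositionalEquality.refl =
  Relation.Binary.PropositionalEquality.refl

Total : ∀ {A B} → PFun A B → Set
Total {A} f = ∀ (a : A) → ∃ λ b → graph f a b

-- 3/2-institutional seeds (Sign, Sen, Ω, T) with Sen a lax
-- 3/2-functor Sign → Pfn.

record Seed : Set₂ where
  field
    Sign : ThreeHalfCat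
  open ThreeHalfCat Sign public
  field
    SenO   : Obj → Set
    Sen    : ∀ {A B} → Hom A B → PFun (SenO A) (SenO B)
    Sen-mono : ∀ {A B} {φ θ : Hom A B} → φ ≤ θ → Sen φ ⊆ᵖ Sen θ
    Sen-lax  : ∀ {A B C} (φ : Hom A B) (φ' : Hom B C) →
               (Sen φ ⨾ᵖ Sen φ') ⊆ᵖ Sen (φ ⨾ φ')
    Sen-laxid : ∀ (A : Obj) → idᵖ (SenO A) ⊆ᵖ Sen (idm A)
    Ω : Obj
    T : SenO Ω → Bool

module SeedNotions (S : Seed) where
  open Seed S

  Maximal : ∀ {A B} → Hom A B → Set
  Maximal {A} {B} φ = ¬ (Σ[ φ' ∈ Hom A B ] (φ' ≢ φ × φ ≤ φ'))

  SenMaximal : ∀ {A B} → Hom A B → Set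
  SenMaximal φ = Total (Sen φ)

  Model : Obj → Set
  Model Σ₀ = Σ[ M ∈ Hom Σ₀ Ω ] Total (Sen M)

  _∈Mod[_]_ : ∀ {A B} → Model A → Hom A B → Model B → Set
  (M , _) ∈Mod[ φ ] (M' , _) = φ ⨾ M' ≤ M

  _⊨_ : ∀ {A} → Model A → SenO A → Set
  _⊨_ (M , tot) ρ = Σ[ x ∈ SenO Ω ] (graph (Sen M) ρ x × T x ≡ true)

  record Subcategory : Set₁ where
    field
      ObjP : Obj → Set
      HomP : ∀ {A B} → Hom A B → Set
      dom∈ : ∀ {A B} {f : Hom A B} → HomP f → ObjP A
      cod∈ : ∀ {A B} {f : Hom A B} → HomP f → ObjP B
      id∈  : ∀ {A} → ObjP A → HomP (idm A)
      ⨾∈   : ∀ {A B C} {f : Hom A B} {g : Hom B C} →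
             HomP f → HomP g → HomP (f ⨾ g)

  record LaxCocone {Σ₀ Σ₁ Σ₂ : Obj} (φ₁ : Hom Σ₀ Σ₁) (φ₂ : Hom Σ₀ Σ₂)
                   (Σ' : Obj) : Set where
    constructor cocone
    field
      θ₀ : Hom Σ₀ Σ'
      θ₁ : Hom Σ₁ Σ'
      θ₂ : Hom Σ₂ Σ'
      lax₁ : φ₁ ⨾ θ₁ ≤ θ₀
      lax₂ : φ₂ ⨾ θ₂ ≤ θ₀

  module _ (𝒯 : Subcategory) where
    open Subcategory 𝒯

    IsLax𝒯Cocone : ∀ {Σ₀ Σ₁ Σ₂ Σ'} {φ₁ : Hom Σ₀ Σ₁} {φ₂ : Hom Σ₀ Σ₂} →
                   LaxCocone φ₁ φ₂ Σ' → Set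
    IsLax𝒯Cocone c = HomP θ₀ × HomP θ₁ × HomP θ₂
      where open LaxCocone c

    IsLax𝒯Pushout : ∀ {Σ₀ Σ₁ Σ₂ Σ'} {φ₁ : Hom Σ₀ Σ₁} {φ₂ : Hom Σ₀ Σ₂} →
                    LaxCocone φ₁ φ₂ Σ' → Set
    IsLax𝒯Pushout {Σ₀} {Σ₁} {Σ₂} {Σ'} {φ₁} {φ₂} c =
      IsLax𝒯Cocone c ×
      (∀ {Σ''} (c' : LaxCocone φ₁ φ₂ Σ'') → IsLax𝒯Cocone c' →
        Σ[ μ ∈ Hom Σ' Σ'' ]
          ((HomP μ × Mediates μ c') ×
           (∀ (μ' : Hom Σ' Σ'') → HomP μ' → Mediates μ' c' → μ' ≡ μ)))
      where
        open LaxCocone c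
        Mediates : ∀ {Σ''} → Hom Σ' Σ'' → LaxCocone φ₁ φ₂ Σ'' → Set
        Mediates μ c' = (θ₀ ⨾ μ ≡ LaxCocone.θ₀ c')
                      × (θ₁ ⨾ μ ≡ LaxCocone.θ₁ c')
                      × (θ₂ ⨾ μ ≡ LaxCocone.θ₂ c')

  record SpanModel {Σ₀ Σ₁ Σ₂ : Obj} (φ₁ : Hom Σ₀ Σ₁) (φ₂ : Hom Σ₀ Σ₂)
                   : Set where
    field
      M₀ : Model Σ₀
      M₁ : Model Σ₁
      M₂ : Model Σ₂
      red₁ : M₀ ∈Mod[ φ₁ ] M₁
      red₂ : M₀ ∈Mod[ φ₂ ] M₂

  WeakModelAmalgamation : ∀ {Σ₀ Σ₁ Σ₂ Σ'} {φ₁ : Hom Σ₀ Σ₁}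
                          {φ₂ : Hom Σ₀ Σ₂} → LaxCocone φ₁ φ₂ Σ' → Set
  WeakModelAmalgamation {φ₁ = φ₁} {φ₂} c =
    (m : SpanModel φ₁ φ₂) →
    Σ[ M ∈ Model _ ] ((SpanModel.M₀ m ∈Mod[ LaxCocone.θ₀ c ] M)
                    × (SpanModel.M₁ m ∈Mod[ LaxCocone.θ₁ c ] M)
                    × (SpanModel.M₂ m ∈Mod[ LaxCocone.θ₂ c ] M))

module Submission where

-- By hypothesis (i) a Σ-model, i.e. an arrow M : Σ → Ω with Sen(M)
-- total, is exactly a maximal arrow into Ω; by (ii) it lies in 𝒯.  Hence
-- a model (M₀, M₁, M₂) of a span is itself a lax 𝒯-cocone of the span with
-- vertex Ω, and the universal property of the lax 𝒯-pushout θ yields a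
-- mediating μ ∈ 𝒯 with θₖ ; μ = Mₖ.  The crux is that μ is maximal: if
-- μ ≤ μ' then Mₖ = θₖ ; μ ≤ θₖ ; μ', so θₖ ; μ' = Mₖ by maximality of Mₖ;
-- by (iii) μ' ∈ 𝒯, so μ' mediates as well and uniqueness forces μ' = μ.
-- Thus μ is Sen-maximal, i.e. a Σ-model, and it amalgamates the Mₖ.
--
-- Maximality is a negative statement, so the equalities θₖ ; μ' = Mₖ are
-- only available doubly negated; this suffices because the goal is itself
-- a negation.

open import Defs
open import Data.Product using (_,_; proj₁)
open import Function.Bundles using (_⇔_; Equivalence)
open import Relation.Nullary using (¬_)
open import Relation.Binary.PropositionalEquality using (_≡_; refl)
open import Relation.Binary.Structures using (IsPartialOrder)

module MaximalMediators (S : Seed) where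
  open Seed S
  open SeedNotions S

  ≤-reflexive : ∀ {A B} {f g : Hom A B} → f ≡ g → f ≤ g
  ≤-reflexive = IsPartialOrder.reflexive ≤-po

  maximal-intro : ∀ {A B} {f : Hom A B} →
                  (∀ g → f ≤ g → ¬ ¬ (g ≡ f)) → Maximal f
  maximal-intro stable (g , g≢f , f≤g) = stable g f≤g g≢f

  maximal-stable : ∀ {A B} {f g : Hom A B} → Maximal f → f ≤ g → ¬ ¬ (g ≡ f)
  maximal-stable max f≤g g≢f = max (_ , g≢f , f≤g)

  ⨾-monoʳ : ∀ {A B C} (θ : Hom A B) {μ μ' : Hom B C} {M : Hom A C} →
            θ ⨾ μ ≡ M → μ ≤ μ' → M ≤ θ ⨾ μ'
  ⨾-monoʳ θ refl μ≤μ' = ⨾-mono (≤-reflexive refl) μ≤μ'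

  record MaximalMediator {Σ₀ Σ₁ Σ₂ Σ' Σ''} {φ₁ : Hom Σ₀ Σ₁} {φ₂ : Hom Σ₀ Σ₂}
         (c : LaxCocone φ₁ φ₂ Σ') (c' : LaxCocone φ₁ φ₂ Σ'') : Set where
    field
      μ         : Hom Σ' Σ''
      μ-maximal : Maximal μ
      mediates₀ : LaxCocone.θ₀ c ⨾ μ ≡ LaxCocone.θ₀ c'
      mediates₁ : LaxCocone.θ₁ c ⨾ μ ≡ LaxCocone.θ₁ c'
      mediates₂ : LaxCocone.θ₂ c ⨾ μ ≡ LaxCocone.θ₂ c'

  mediator-maximal :
    (𝒯 : Subcategory) →
    (∀ {A B} (φ φ' : Hom A B) → Subcategory.HomP 𝒯 φ → φ ≤ φ' →
       Subcategory.HomP 𝒯 φ') →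
    ∀ {Σ₀ Σ₁ Σ₂ Σ' Σ''} {φ₁ : Hom Σ₀ Σ₁} {φ₂ : Hom Σ₀ Σ₂}
    (c : LaxCocone φ₁ φ₂ Σ') (c' : LaxCocone φ₁ φ₂ Σ'') →
    IsLax𝒯Pushout 𝒯 c → IsLax𝒯Cocone 𝒯 c' →
    Maximal (LaxCocone.θ₀ c') → Maximal (LaxCocone.θ₁ c') →
    Maximal (LaxCocone.θ₂ c') →
    MaximalMediator c c'
  mediator-maximal 𝒯 up-closed c c' (_ , universal) c'∈𝒯 max₀ max₁ max₂
    with universal c' c'∈𝒯
  ... | μ , (μ∈𝒯 , e₀ , e₁ , e₂) , unique =
    record { μ = μ ; μ-maximal = maximal-intro stable
           ; mediates₀ = e₀ ; mediates₁ = e₁ ; mediates₂ = e₂ }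
    where
    open LaxCocone c

    -- any μ' ≥ μ still mediates (up to double negation), hence equals μ
    stable : ∀ μ' → μ ≤ μ' → ¬ ¬ (μ' ≡ μ)
    stable μ' μ≤μ' μ'≢μ =
      maximal-stable max₀ (⨾-monoʳ θ₀ e₀ μ≤μ') λ e₀' →
      maximal-stable max₁ (⨾-monoʳ θ₁ e₁ μ≤μ') λ e₁' →
      maximal-stable max₂ (⨾-monoʳ θ₂ e₂ μ≤μ') λ e₂' →
      μ'≢μ (unique μ' (up-closed μ μ' μ∈𝒯 μ≤μ') (e₀' , e₁' , e₂'))

  model-maximal : (∀ {A B} (φ : Hom A B) → Maximal φ ⇔ SenMaximal φ) →
                  ∀ {A} (N : Model A) → Maximal (proj₁ N)
  model-maximal max⇔senMax (N , total) = Equivalence.from (max⇔senMax N) total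

  maximal-model : (∀ {A B} (φ : Hom A B) → Maximal φ ⇔ SenMaximal φ) →
                  ∀ {A} (μ : Hom A Ω) → Maximal μ → Model A
  maximal-model max⇔senMax μ max = μ , Equivalence.to (max⇔senMax μ) max

  spanCocone : ∀ {Σ₀ Σ₁ Σ₂} {φ₁ : Hom Σ₀ Σ₁} {φ₂ : Hom Σ₀ Σ₂} →
               SpanModel φ₁ φ₂ → LaxCocone φ₁ φ₂ Ω
  spanCocone m = cocone (proj₁ M₀) (proj₁ M₁) (proj₁ M₂) red₁ red₂
    where open SpanModel m

mainTheorem2 : (S : Seed) → let open Seed S in let open SeedNotions S in
    (𝒯 : Subcategory) →
    (∀ {A B} (φ : Hom A B) → Maximal φ ⇔ SenMaximal φ) →
    (∀ {A B} (φ : Hom A B) → Maximal φ → Subcategory.HomP 𝒯 φ) →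
    (∀ {A B} (φ φ' : Hom A B) → Subcategory.HomP 𝒯 φ → φ ≤ φ' → Subcategory.HomP 𝒯 φ') →
    ∀ {Σ₀ Σ₁ Σ₂ Σ'} (φ₁ : Hom Σ₀ Σ₁) (φ₂ : Hom Σ₀ Σ₂) (c : LaxCocone φ₁ φ₂ Σ') →
    IsLax𝒯Pushout 𝒯 c → WeakModelAmalgamation c
mainTheorem2 S 𝒯 max⇔senMax max⇒𝒯 up-closed φ₁ φ₂ c pushout m =
  maximal-model max⇔senMax μ μ-maximal ,
  ≤-reflexive mediates₀ , ≤-reflexive mediates₁ , ≤-reflexive mediates₂
  where
  open Seed S
  open SeedNotions S
  open MaximalMediators S
  open SpanModel m

  model∈𝒯 : ∀ {A} (N : Model A) → Subcategory.HomP 𝒯 (proj₁ N)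
  model∈𝒯 N = max⇒𝒯 (proj₁ N) (model-maximal max⇔senMax N)

  open MaximalMediator
    (mediator-maximal 𝒯 up-closed c (spanCocone m) pushout
       (model∈𝒯 M₀ , model∈𝒯 M₁ , model∈𝒯 M₂)
       (model-maximal max⇔senMax M₀) (model-maximal max⇔senMax M₁)
       (model-maximal max⇔senMax M₂))
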